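{- Let $\mathcal{G}$ be the Sprague–Grundy function of Exco-Nim with $n=2$. Let $x=(x_0,x_1,x_2)$ be a position with $x_1\le x_2$ and $\mathcal{G}(x)=v$, where $v$ is a positive integer, and let $k=k(v)$ be the unique integer with $2^{k-1}\le v<2^{k}$. Then there exist a position $\hat x=(\hat x_0,\hat x_1,\hat x_2)$ with $\hat x_0\le v$, $\hat x_1\le 2^{k-1}-1$, $\hat x_2\le 2^{k}-1$ and $\mathcal{G}(\hat x)=\mathcal{G}(x)$, and a nonnegative integer $\lambda$, such that $x=\hat x+\lambda\,(0,2^{k},2^{k})$.
   Context: Exco-Nim with $n=2$: positions are triples $x=(x_0,x_1,x_2)$ of nonnegative integers. A legal move $x\to x'$ is to a triple $x'$ of nonnegative integers with $x'_j\le x_j$ for $j=0,1,2$, $x'_0+x'_1+x'_2<x_0+x_1+x_2$, and $x'_1=x_1$ or $x'_2=x_2$. The Sprague–Grundy function is $\mathcal{G}(x)=\operatorname{mex}\{\mathcal{G}(x'): x\to x'\}$, where $\operatorname{mex}(S)$ is the least nonnegative integer not in $S$. -}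

module Defs where

open import Data.Nat using (ℕ; _+_; _≤_; _<_)
open import Data.Product using (_×_; Σ; ∃; _,_)
open import Data.Sum using (_⊎_)
open import Relation.Binary.PropositionalEquality using (_≡_; _≢_)

Pos : Set
Pos = ℕ × ℕ × ℕ

Move : Pos → Pos → Set
Move (x₀ , x₁ , x₂) (y₀ , y₁ , y₂) =
  y₀ ≤ x₀ × y₁ ≤ x₁ × y₂ ≤ x₂ × (y₀ + y₁ + y₂ < x₀ + x₁ + x₂) × (y₁ ≡ x₁ ⊎ y₂ ≡ x₂)

IsMex : (ℕ → Set) → ℕ → Set
IsMex S m = (S m → Data.Empty.⊥) × (∀ j → j < m → S j)
  where import Data.Empty

OptionValues : (Pos → ℕ) → Pos → ℕ → Set
OptionValues g x v = Σ Pos λ y → Move x y × g y ≡ v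

-- g is the Sprague–Grundy function: G(x) = mex { G(x') : x → x' } for all x.
-- (The move relation is well-founded, the total decreasing, so this g exists
-- and is unique.)
IsSG : (Pos → ℕ) → Set
IsSG g = ∀ x → IsMex (OptionValues g x) (g x)

-- On the plane x₀ = 0 the game is two-heap Nim, so
--    G(0, a, b) = a ⊕ b; each token of heap 0 raises the value, giving
--    G(x₀, a, b) ≥ x₀ + a ⊕ b. Hence in a position of value below P = 2^k
--    heaps 1 and 2 have the same quotient by P, and shifting both heaps by P
--    leaves such a value unchanged (the options below P correspond).
-- 3. The theorem. Reduce x₁, x₂ modulo P = 2^k with λ = x₂ / P; the residue
--    x̂₁ is below 2^(k-1), since otherwise an option (0, y, x̂₂) of value v
--    exists; and x₀ ≤ v by the lower bound of 2.
module Submission where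

open import Defs
open import Data.Nat using (ℕ; _+_; _*_; _∸_; _^_; _≤_; _<_)
open import Data.Product using (_×_; Σ; _,_)
open import Relation.Binary.PropositionalEquality using (_≡_)

open import Data.Nat using (zero; suc; z≤n; s≤s; s≤s⁻¹; NonZero; ⌊_/2⌋; parity)
open import Data.Nat.Properties
open import Data.Nat.DivMod using (_/_; _%_; m≡m%n+[m/n]*n; m%n<n; m≥n⇒m/n>0; m/n≢0⇒n≤m)
open import Data.Nat.Induction using (<-wellFounded)
open import Data.Nat.Tactic.RingSolver using (solve-∀)
open import Data.Parity.Base as ℙ using (Parity; 0ℙ; 1ℙ)
import Data.Parity.Properties as ℙₚ
open import Data.Product using (proj₁; proj₂; ∃-syntax)
open import Data.Sum as Sum using (_⊎_; inj₁; inj₂)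
open import Data.Empty using (⊥; ⊥-elim)
open import Function using (case_of_)
import Induction.WellFounded as WF
open import Level using (0ℓ)
import Relation.Binary.Construct.On as On
open import Relation.Binary.PropositionalEquality
open import Relation.Binary.Definitions using (tri<; tri≈; tri>)

digit : Parity → ℕ
digit 0ℙ = 0
digit 1ℙ = 1

digit≤1 : ∀ p → digit p ≤ 1
digit≤1 0ℙ = z≤n
digit≤1 1ℙ = s≤s z≤n

digit-+2 : ∀ p a → digit p + 2 * suc a ≡ 2 + (digit p + 2 * a)
digit-+2 p a = begin
  digit p + 2 * suc a          ≡⟨ cong (digit p +_) (*-suc 2 a) ⟩
  digit p + (2 + 2 * a)        ≡⟨ +-suc (digit p) (suc (2 * a)) ⟩
  suc (digit p + suc (2 * a))  ≡⟨ cong suc (+-suc (digit p) (2 * a)) ⟩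
  2 + (digit p + 2 * a)        ∎
  where open ≡-Reasoning

digit-decomposition : ∀ n → digit (parity n) + 2 * ⌊ n /2⌋ ≡ n
digit-decomposition zero = refl
digit-decomposition (suc zero) = refl
digit-decomposition (suc (suc n))
  rewrite digit-+2 (parity n) ⌊ n /2⌋ = cong (2 +_) (digit-decomposition n)

parity-digit : ∀ p a → parity (digit p + 2 * a) ≡ p
parity-digit 0ℙ zero = refl
parity-digit 1ℙ zero = refl
parity-digit p (suc a) rewrite digit-+2 p a = parity-digit p a

half-digit : ∀ p a → ⌊ digit p + 2 * a /2⌋ ≡ a
half-digit 0ℙ zero = refl
half-digit 1ℙ zero = refl
half-digit p (suc a) rewrite digit-+2 p a = cong suc (half-digit p a)

data Binary : ℕ → Set where
  bin : (p : Parity) (a : ℕ) → Binary (digit p + 2 * a)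

binary : ∀ n → Binary n
binary n = subst Binary (digit-decomposition n) (bin (parity n) ⌊ n /2⌋)

half-≤ : ∀ {n} f → n ≤ suc f → ⌊ n /2⌋ ≤ f
half-≤ f le = ≤-trans (⌊n/2⌋-mono le) (s≤s⁻¹ (⌊n/2⌋<n f))

halve-≤ : ∀ p a f → digit p + 2 * a ≤ suc f → a ≤ f
halve-≤ p a f le = subst (_≤ f) (half-digit p a) (half-≤ f le)

halve-< : ∀ p a Q → digit p + 2 * a < 2 * Q → a < Q
halve-< p a Q lt = *-cancelˡ-< 2 a Q (≤-<-trans (m≤n+m (2 * a) (digit p)) lt)

double-< : ∀ p a Q → a < Q → digit p + 2 * a < 2 * Q
double-< p a Q a<Q = begin-strict
  digit p + 2 * a  <⟨ s≤s (+-monoˡ-≤ (2 * a) (digit≤1 p)) ⟩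
  2 + 2 * a        ≡⟨ *-suc 2 a ⟨
  2 * suc a        ≤⟨ *-monoʳ-≤ 2 a<Q ⟩
  2 * Q            ∎
  where open ≤-Reasoning

-- The recursion is bounded by fuel f ≥ a, b, c, which halving decreases.
binary-induction₃ : (P : ℕ → ℕ → ℕ → Set) → P 0 0 0 →
  (∀ p q r a b c → P a b c → P (digit p + 2 * a) (digit q + 2 * b) (digit r + 2 * c)) →
  ∀ a b c → P a b c
binary-induction₃ P base step a b c =
  bounded (a + b + c) a b c (≤-trans (m≤m+n a b) (m≤m+n (a + b) c))
    (≤-trans (m≤n+m b a) (m≤m+n (a + b) c)) (m≤n+m c (a + b))
  where
  bounded : ∀ f a b c → a ≤ f → b ≤ f → c ≤ f → P a b c
  bounded zero .0 .0 .0 z≤n z≤n z≤n = base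
  bounded (suc f) a b c a≤ b≤ c≤ with binary a | binary b | binary c
  ... | bin p a' | bin q b' | bin r c' =
    step p q r a' b' c'
      (bounded f a' b' c' (halve-≤ p a' f a≤) (halve-≤ q b' f b≤) (halve-≤ r c' f c≤))

binary-induction₂ : (P : ℕ → ℕ → Set) → P 0 0 →
  (∀ p q a b → P a b → P (digit p + 2 * a) (digit q + 2 * b)) → ∀ a b → P a b
binary-induction₂ P base step a b =
  binary-induction₃ (λ a b _ → P a b) base (λ p q _ a b _ → step p q a b) a b 0

nimSumWithin : ℕ → ℕ → ℕ → ℕ
nimSumWithin zero a b = 0
nimSumWithin (suc f) a b =
  digit (parity a ℙ.+ parity b) + 2 * nimSumWithin f ⌊ a /2⌋ ⌊ b /2⌋

infixl 6 _⊕_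
_⊕_ : ℕ → ℕ → ℕ
a ⊕ b = nimSumWithin (suc (a + b)) a b

nimSumWithin-zeros : ∀ f → nimSumWithin f 0 0 ≡ 0
nimSumWithin-zeros zero = refl
nimSumWithin-zeros (suc f) = cong (2 *_) (nimSumWithin-zeros f)

nimSumWithin-stable : ∀ f f' a b → a ≤ f → b ≤ f → a ≤ f' → b ≤ f' →
  nimSumWithin f a b ≡ nimSumWithin f' a b
nimSumWithin-stable zero f' .0 .0 z≤n z≤n _ _ = sym (nimSumWithin-zeros f')
nimSumWithin-stable (suc f) zero .0 .0 _ _ z≤n z≤n = nimSumWithin-zeros (suc f)
nimSumWithin-stable (suc f) (suc f') a b a≤f b≤f a≤f' b≤f' =
  cong (λ z → digit (parity a ℙ.+ parity b) + 2 * z)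
    (nimSumWithin-stable f f' ⌊ a /2⌋ ⌊ b /2⌋
      (half-≤ f a≤f) (half-≤ f b≤f) (half-≤ f' a≤f') (half-≤ f' b≤f'))

≤-append-digit : ∀ p a → a ≤ digit p + 2 * a
≤-append-digit p a = ≤-trans (m≤m+n a (a + 0)) (m≤n+m (2 * a) (digit p))

⊕-step : ∀ p q a b → (digit p + 2 * a) ⊕ (digit q + 2 * b) ≡ digit (p ℙ.+ q) + 2 * (a ⊕ b)
⊕-step p q a b
  rewrite parity-digit p a | parity-digit q b | half-digit p a | half-digit q b =
  cong (λ z → digit (p ℙ.+ q) + 2 * z)
    (nimSumWithin-stable (A + B) (suc (a + b)) a b
      (≤-trans (≤-append-digit p a) (m≤m+n A B)) (≤-trans (≤-append-digit q b) (m≤n+m B A))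
      (m≤n⇒m≤1+n (m≤m+n a b)) (m≤n⇒m≤1+n (m≤n+m b a)))
  where
  A B : ℕ
  A = digit p + 2 * a
  B = digit q + 2 * b

parity-cancelʳ : ∀ p q → p ℙ.+ q ℙ.+ q ≡ p
parity-cancelʳ p q = begin
  p ℙ.+ q ℙ.+ q    ≡⟨ ℙₚ.+-assoc p q q ⟩
  p ℙ.+ (q ℙ.+ q)  ≡⟨ cong (p ℙ.+_) (ℙₚ.p+p≡0ℙ q) ⟩
  p ℙ.+ 0ℙ         ≡⟨ ℙₚ.+-identityʳ p ⟩
  p                ∎
  where open ≡-Reasoning

parity-cancelˡ : ∀ p q → p ℙ.+ (p ℙ.+ q) ≡ q
parity-cancelˡ p q = begin
  p ℙ.+ (p ℙ.+ q)  ≡⟨ ℙₚ.+-assoc p p q ⟨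
  p ℙ.+ p ℙ.+ q    ≡⟨ cong (ℙ._+ q) (ℙₚ.p+p≡0ℙ p) ⟩
  q                ∎
  where open ≡-Reasoning

digits-cong : ∀ {p p' a a'} → p ≡ p' → a ≡ a' → digit p + 2 * a ≡ digit p' + 2 * a'
digits-cong = cong₂ (λ p a → digit p + 2 * a)

⊕-comm : ∀ a b → a ⊕ b ≡ b ⊕ a
⊕-comm = binary-induction₂ (λ a b → a ⊕ b ≡ b ⊕ a) refl λ p q a b ih → begin
  (digit p + 2 * a) ⊕ (digit q + 2 * b)  ≡⟨ ⊕-step p q a b ⟩
  digit (p ℙ.+ q) + 2 * (a ⊕ b)          ≡⟨ digits-cong (ℙₚ.+-comm p q) ih ⟩
  digit (q ℙ.+ p) + 2 * (b ⊕ a)          ≡⟨ ⊕-step q p b a ⟨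
  (digit q + 2 * b) ⊕ (digit p + 2 * a)  ∎
  where open ≡-Reasoning

⊕-self : ∀ a → a ⊕ a ≡ 0
⊕-self a = binary-induction₂ (λ a _ → a ⊕ a ≡ 0) refl
  (λ p _ a _ ih → trans (⊕-step p p a a) (digits-cong (ℙₚ.p+p≡0ℙ p) ih)) a 0

⊕-involutive : ∀ a b → (a ⊕ b) ⊕ b ≡ a
⊕-involutive = binary-induction₂ (λ a b → (a ⊕ b) ⊕ b ≡ a) refl λ p q a b ih → begin
  ((digit p + 2 * a) ⊕ (digit q + 2 * b)) ⊕ (digit q + 2 * b)
    ≡⟨ cong (_⊕ (digit q + 2 * b)) (⊕-step p q a b) ⟩
  (digit (p ℙ.+ q) + 2 * (a ⊕ b)) ⊕ (digit q + 2 * b)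
    ≡⟨ ⊕-step (p ℙ.+ q) q (a ⊕ b) b ⟩
  digit (p ℙ.+ q ℙ.+ q) + 2 * ((a ⊕ b) ⊕ b)
    ≡⟨ digits-cong (parity-cancelʳ p q) ih ⟩
  digit p + 2 * a ∎
  where open ≡-Reasoning

⊕-cancelʳ : ∀ a a' b → a ⊕ b ≡ a' ⊕ b → a ≡ a'
⊕-cancelʳ a a' b e = begin
  a            ≡⟨ ⊕-involutive a b ⟨
  (a ⊕ b) ⊕ b  ≡⟨ cong (_⊕ b) e ⟩
  (a' ⊕ b) ⊕ b ≡⟨ ⊕-involutive a' b ⟩
  a'           ∎
  where open ≡-Reasoning

⊕-cancelˡ : ∀ a b b' → a ⊕ b ≡ a ⊕ b' → b ≡ b'
⊕-cancelˡ a b b' e = ⊕-cancelʳ b b' a (trans (⊕-comm b a) (trans e (⊕-comm a b')))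

digits-< : ∀ e c w m → digit e + 2 * w < digit c + 2 * m →
  w < m ⊎ (w ≡ m × e ≡ 0ℙ × c ≡ 1ℙ)
digits-< e c w m lt with <-cmp w m
... | tri< w<m _ _ = inj₁ w<m
... | tri≈ _ refl _ = inj₂ (refl , last-digits e c (+-cancelʳ-< (2 * w) (digit e) (digit c) lt))
  where
  last-digits : ∀ e c → digit e < digit c → e ≡ 0ℙ × c ≡ 1ℙ
  last-digits 0ℙ 1ℙ _ = refl , refl
  last-digits 0ℙ 0ℙ ()
  last-digits 1ℙ 0ℙ ()
  last-digits 1ℙ 1ℙ (s≤s ())
... | tri> _ _ m<w =
  ⊥-elim (<-asym lt (<-≤-trans (double-< c m w m<w) (m≤n+m (2 * w) (digit e))))

-- The nim-sum property behind Bouton's theorem: every value below a ⊕ b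
-- is a ⊕ b with exactly one of the arguments decreased.
ReachableBelow : ℕ → ℕ → ℕ → Set
ReachableBelow a b w =
  w < a ⊕ b → (∃[ a' ] a' < a × a' ⊕ b ≡ w) ⊎ (∃[ b' ] b' < b × a ⊕ b' ≡ w)

⊕-mex : ∀ a b w → ReachableBelow a b w
⊕-mex = binary-induction₃ ReachableBelow (λ ()) step
  where
  step : ∀ p q e a b w → ReachableBelow a b w →
    ReachableBelow (digit p + 2 * a) (digit q + 2 * b) (digit e + 2 * w)
  step p q e a b w ih lt
    with digits-< e (p ℙ.+ q) w (a ⊕ b) (subst (digit e + 2 * w <_) (⊕-step p q a b) lt)
  ... | inj₁ w< with ih w<
  ...   | inj₁ (a' , a'<a , a'⊕b≡w) =
    inj₁ (digit (e ℙ.+ q) + 2 * a' ,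
          <-≤-trans (double-< (e ℙ.+ q) a' a a'<a) (m≤n+m (2 * a) (digit p)) ,
          trans (⊕-step (e ℙ.+ q) q a' b) (digits-cong (parity-cancelʳ e q) a'⊕b≡w))
  ...   | inj₂ (b' , b'<b , a⊕b'≡w) =
    inj₂ (digit (p ℙ.+ e) + 2 * b' ,
          <-≤-trans (double-< (p ℙ.+ e) b' b b'<b) (m≤n+m (2 * b) (digit q)) ,
          trans (⊕-step p (p ℙ.+ e) a b') (digits-cong (parity-cancelˡ p e) a⊕b'≡w))
  step 1ℙ 0ℙ e a b w ih lt | inj₂ (refl , refl , _) = inj₁ (2 * a , ≤-refl , ⊕-step 0ℙ 0ℙ a b)
  step 0ℙ 1ℙ e a b w ih lt | inj₂ (refl , refl , _) = inj₂ (2 * b , ≤-refl , ⊕-step 0ℙ 0ℙ a b)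
  step 0ℙ 0ℙ e a b w ih lt | inj₂ (_ , _ , ())
  step 1ℙ 1ℙ e a b w ih lt | inj₂ (_ , _ , ())

⊕-bound : ∀ k r s → r < 2 ^ k → s < 2 ^ k → r ⊕ s < 2 ^ k
⊕-bound zero .0 .0 (s≤s z≤n) (s≤s z≤n) = s≤s z≤n
⊕-bound (suc k) r s r< s< with binary r | binary s
... | bin p a | bin q b = subst (_< 2 ^ suc k) (sym (⊕-step p q a b))
  (double-< (p ℙ.+ q) (a ⊕ b) (2 ^ k)
    (⊕-bound k a b (halve-< p a (2 ^ k) r<) (halve-< q b (2 ^ k) s<)))

digits-regroup : ∀ d a h Q → (d + 2 * a) + h * (2 * Q) ≡ d + 2 * (a + h * Q)
digits-regroup = solve-∀

⊕-block : ∀ k h h' r s → r < 2 ^ k → s < 2 ^ k →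
  (r + h * 2 ^ k) ⊕ (s + h' * 2 ^ k) ≡ (r ⊕ s) + (h ⊕ h') * 2 ^ k
⊕-block zero h h' .0 .0 (s≤s z≤n) (s≤s z≤n)
  rewrite *-identityʳ h | *-identityʳ h' | *-identityʳ (h ⊕ h') = refl
⊕-block (suc k) h h' r s r< s< with binary r | binary s
... | bin p a | bin q b = begin
  (A + h * (2 * Q)) ⊕ (B + h' * (2 * Q))
    ≡⟨ cong₂ _⊕_ (shift-digits (digit p) a h) (shift-digits (digit q) b h') ⟩
  (digit p + 2 * (a + h * Q)) ⊕ (digit q + 2 * (b + h' * Q))
    ≡⟨ ⊕-step p q (a + h * Q) (b + h' * Q) ⟩
  digit (p ℙ.+ q) + 2 * ((a + h * Q) ⊕ (b + h' * Q))
    ≡⟨ cong (λ z → digit (p ℙ.+ q) + 2 * z)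
         (⊕-block k h h' a b (halve-< p a Q r<) (halve-< q b Q s<)) ⟩
  digit (p ℙ.+ q) + 2 * ((a ⊕ b) + (h ⊕ h') * Q)
    ≡⟨ shift-digits (digit (p ℙ.+ q)) (a ⊕ b) (h ⊕ h') ⟨
  (digit (p ℙ.+ q) + 2 * (a ⊕ b)) + (h ⊕ h') * (2 * Q)
    ≡⟨ cong (_+ (h ⊕ h') * (2 * Q)) (⊕-step p q a b) ⟨
  (A ⊕ B) + (h ⊕ h') * (2 * Q) ∎
  where
  open ≡-Reasoning
  Q A B : ℕ
  Q = 2 ^ k
  A = digit p + 2 * a
  B = digit q + 2 * b
  shift-digits : ∀ d a h → (d + 2 * a) + h * (2 * Q) ≡ d + 2 * (a + h * Q)
  shift-digits d a h = digits-regroup d a h Q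

mex-≥ : ∀ {S : ℕ → Set} {m n} → IsMex S m → (∀ j → j < n → S j) → n ≤ m
mex-≥ (m∉S , _) below = ≮⇒≥ (λ m<n → m∉S (below _ m<n))

mex-agree : ∀ {S T : ℕ → Set} {m n} B → IsMex S m → IsMex T n →
  (∀ w → w < B → S w → T w) → (∀ w → w < B → T w → S w) → m < B → m ≡ n
mex-agree {m = m} {n} B (m∉S , S-below) (n∉T , T-below) S⊆T T⊆S m<B with <-cmp m n
... | tri< m<n _ _ = ⊥-elim (m∉S (T⊆S m m<B (T-below m m<n)))
... | tri≈ _ m≡n _ = m≡n
... | tri> _ _ n<m = ⊥-elim (n∉T (S⊆T n (<-trans n<m m<B) (S-below n n<m)))

mex-unique : ∀ {S : ℕ → Set} {m n} → IsMex S m → IsMex S n → m ≡ n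
mex-unique {m = m} Sm Sn = mex-agree (suc m) Sm Sn (λ _ _ s → s) (λ _ _ s → s) (n<1+n m)

multiple-below : ∀ u t P → u + t * P < P → t ≡ 0
multiple-below u zero P _ = refl
multiple-below u (suc t) P lt =
  ⊥-elim (<⇒≱ lt (≤-trans (m≤m+n P (t * P)) (m≤n+m (P + t * P) u)))

≤-same-quotient : ∀ {a b P} .{{_ : NonZero P}} → a / P ≡ b / P → P ≤ a → P ≤ b
≤-same-quotient same P≤a = m/n≢0⇒n≤m (λ b/P≡0 → n>0⇒n≢0 (m≥n⇒m/n>0 P≤a) (trans same b/P≡0))

∸-half-below : ∀ {u} H .{{_ : NonZero H}} → u < 2 * H → u ∸ H < H
∸-half-below {u} H u<2H = m<n+o⇒m∸n<o u H (subst (u <_) (cong (H +_) (+-identityʳ H)) u<2H)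

lift-regroup : ∀ a b c P → a + (b + P) + (c + P) ≡ a + b + c + (P + P)
lift-regroup = solve-∀

one-more-block : ∀ r l P → r + suc l * P ≡ r + l * P + P
one-more-block = solve-∀

size : Pos → ℕ
size (x₀ , x₁ , x₂) = x₀ + x₁ + x₂

move-size : ∀ {x y} → Move x y → size y < size x
move-size {_ , _ , _} {_ , _ , _} (_ , _ , _ , smaller , _) = smaller

size-rec : (Q : Pos → Set) → (∀ x → (∀ {y} → size y < size x → Q y) → Q x) → ∀ x → Q x
size-rec Q = WF.All.wfRec (On.wellFounded size <-wellFounded) 0ℓ Q

move-weaken₀ : ∀ {x₀ a b} y → Move (x₀ , a , b) y → Move (suc x₀ , a , b) y
move-weaken₀ _ (y₀≤ , y₁≤ , y₂≤ , smaller , fixed) =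
  m≤n⇒m≤1+n y₀≤ , y₁≤ , y₂≤ , m<n⇒m<1+n smaller , fixed

module ExcoNim (g : Pos → ℕ) (sg : IsSG g) where

  -- On the plane x₀ = 0 the game is two-heap Nim, so its values are nim-sums.
  nim-plane : ∀ a b → g (0 , a , b) ≡ a ⊕ b
  nim-plane a b = size-rec NimValue step (0 , a , b) refl
    where
    NimValue : Pos → Set
    NimValue (x₀ , a , b) = x₀ ≡ 0 → g (x₀ , a , b) ≡ a ⊕ b
    step : ∀ x → (∀ {y} → size y < size x → NimValue y) → NimValue x
    step (.0 , a , b) ih refl = mex-unique (sg (0 , a , b)) (a⊕b-unreached , below-reached)
      where
      a⊕b-unreached : OptionValues g (0 , a , b) (a ⊕ b) → ⊥
      a⊕b-unreached ((.0 , y₁ , y₂) , (z≤n , _ , _ , smaller , inj₁ y₁≡a) , gy≡) =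
        <-irrefl (cong₂ _+_ y₁≡a y₂≡b) smaller
        where
        y₂≡b : y₂ ≡ b
        y₂≡b = ⊕-cancelˡ a y₂ b (trans (sym (trans (ih smaller refl) (cong (_⊕ y₂) y₁≡a))) gy≡)
      a⊕b-unreached ((.0 , y₁ , y₂) , (z≤n , _ , _ , smaller , inj₂ y₂≡b) , gy≡) =
        <-irrefl (cong₂ _+_ y₁≡a y₂≡b) smaller
        where
        y₁≡a : y₁ ≡ a
        y₁≡a = ⊕-cancelʳ y₁ a b (trans (sym (trans (ih smaller refl) (cong (y₁ ⊕_) y₂≡b))) gy≡)
      below-reached : ∀ w → w < a ⊕ b → OptionValues g (0 , a , b) w
      below-reached w w< with ⊕-mex a b w w<
      ... | inj₁ (a' , a'<a , a'⊕b≡w) =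
        (0 , a' , b) , (z≤n , <⇒≤ a'<a , ≤-refl , +-monoˡ-< b a'<a , inj₂ refl) ,
        trans (ih (+-monoˡ-< b a'<a) refl) a'⊕b≡w
      ... | inj₂ (b' , b'<b , a⊕b'≡w) =
        (0 , a , b') , (z≤n , ≤-refl , <⇒≤ b'<b , +-monoʳ-< a b'<b , inj₁ refl) ,
        trans (ih (+-monoʳ-< a b'<b) refl) a⊕b'≡w

  -- Adding a token to heap 0 strictly increases the value: the position
  -- itself and all of its options become options.
  g-increasing₀ : ∀ x₀ a b → g (x₀ , a , b) < g (suc x₀ , a , b)
  g-increasing₀ x₀ a b = mex-≥ (sg (suc x₀ , a , b)) reached
    where
    reached : ∀ j → j < suc (g (x₀ , a , b)) → OptionValues g (suc x₀ , a , b) j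
    reached j j≤ with m≤n⇒m<n∨m≡n (s≤s⁻¹ j≤)
    ... | inj₁ j< with proj₂ (sg (x₀ , a , b)) j j<
    ...   | y , move , gy≡j = y , move-weaken₀ y move , gy≡j
    reached j j≤ | inj₂ refl =
      (x₀ , a , b) , (n≤1+n x₀ , ≤-refl , ≤-refl , ≤-refl , inj₁ refl) , refl

  lower-bound : ∀ x₀ a b → x₀ + (a ⊕ b) ≤ g (x₀ , a , b)
  lower-bound zero a b = ≤-reflexive (sym (nim-plane a b))
  lower-bound (suc x₀) a b = <-≤-trans (s≤s (lower-bound x₀ a b)) (g-increasing₀ x₀ a b)

  module Period (k : ℕ) where

    P : ℕ
    P = 2 ^ k

    instance
      P-nonZero : NonZero P
      P-nonZero = m^n≢0 2 k

    -- In a position of value below P, heaps 1 and 2 lie in the same block of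
    -- length P: the high parts cancel in the nim-sum, which is below P.
    same-block : ∀ x₀ a b → g (x₀ , a , b) < P → a / P ≡ b / P
    same-block x₀ a b g< =
      ⊕-cancelʳ (a / P) (b / P) (b / P) (trans high≡0 (sym (⊕-self (b / P))))
      where
      a⊕b<P : a ⊕ b < P
      a⊕b<P = ≤-<-trans (m≤n+m (a ⊕ b) x₀) (≤-<-trans (lower-bound x₀ a b) g<)
      split : a ⊕ b ≡ (a % P ⊕ b % P) + (a / P ⊕ b / P) * P
      split = trans (cong₂ _⊕_ (m≡m%n+[m/n]*n a P) (m≡m%n+[m/n]*n b P))
                    (⊕-block k (a / P) (b / P) (a % P) (b % P) (m%n<n a P) (m%n<n b P))
      high≡0 : a / P ⊕ b / P ≡ 0
      high≡0 = multiple-below (a % P ⊕ b % P) (a / P ⊕ b / P) P (subst (_< P) split a⊕b<P)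

    large-together : ∀ x₀ a b → g (x₀ , a , b) < P → P ≤ a ⊎ P ≤ b → P ≤ a × P ≤ b
    large-together x₀ a b g< (inj₁ P≤a) = P≤a , ≤-same-quotient (same-block x₀ a b g<) P≤a
    large-together x₀ a b g< (inj₂ P≤b) = ≤-same-quotient (sym (same-block x₀ a b g<)) P≤b , P≤b

    lift : Pos → Pos
    lift (y₀ , y₁ , y₂) = y₀ , y₁ + P , y₂ + P

    -- Lifting adds 2P tokens, so lifting preserves and reflects moves.
    size-lift : ∀ y → size (lift y) ≡ size y + (P + P)
    size-lift (y₀ , y₁ , y₂) = lift-regroup y₀ y₁ y₂ P

    lift-move : ∀ y z → Move y z → Move (lift y) (lift z)
    lift-move y@(_ , _ , _) z@(_ , _ , _) (z₀≤ , z₁≤ , z₂≤ , smaller , fixed) =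
      z₀≤ , +-monoˡ-≤ P z₁≤ , +-monoˡ-≤ P z₂≤ ,
      subst₂ _<_ (sym (size-lift z)) (sym (size-lift y)) (+-monoˡ-< (P + P) smaller) ,
      Sum.map (cong (_+ P)) (cong (_+ P)) fixed

    unlift-move : ∀ y z → Move (lift y) (lift z) → Move y z
    unlift-move y@(_ , y₁ , y₂) z@(_ , z₁ , z₂) (z₀≤ , z₁≤ , z₂≤ , smaller , fixed) =
      z₀≤ , +-cancelʳ-≤ P z₁ y₁ z₁≤ , +-cancelʳ-≤ P z₂ y₂ z₂≤ ,
      +-cancelʳ-< (P + P) (size z) (size y) (subst₂ _<_ (size-lift z) (size-lift y) smaller) ,
      Sum.map (+-cancelʳ-≡ P z₁ y₁) (+-cancelʳ-≡ P z₂ y₂) fixed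

    shifted-large : ∀ {a} y → a ≡ y + P → P ≤ a
    shifted-large y refl = m≤n+m P y

    -- An option of a lifted position whose value is below P is itself lifted:
    -- the heap kept fixed is at least P, hence so is the other one.
    small-option-lifted : ∀ y a → Move (lift y) a → g a < P → ∃[ z ] lift z ≡ a
    small-option-lifted (_ , y₁ , y₂) (a₀ , a₁ , a₂) (_ , _ , _ , _ , fixed) g<
      with large-together a₀ a₁ a₂ g< (Sum.map (shifted-large y₁) (shifted-large y₂) fixed)
    ... | P≤a₁ , P≤a₂ =
      (a₀ , a₁ ∸ P , a₂ ∸ P) , cong₂ (λ u v → a₀ , u , v) (m∸n+n≡m P≤a₁) (m∸n+n≡m P≤a₂)

    -- Lifting preserves the value whenever one of the two values is below P:
    -- below P, the options of y and of lift y realise the same values.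
    lift-invariant : ∀ y → g (lift y) < P ⊎ g y < P → g (lift y) ≡ g y
    lift-invariant = size-rec _ step
      where
      step : ∀ y → (∀ {z} → size z < size y → g (lift z) < P ⊎ g z < P → g (lift z) ≡ g z) →
        g (lift y) < P ⊎ g y < P → g (lift y) ≡ g y
      step y ih small = case small of λ where
          (inj₁ lt) → mex-agree P (sg (lift y)) (sg y) down up lt
          (inj₂ lt) → sym (mex-agree P (sg y) (sg (lift y)) up down lt)
        where
        down : ∀ w → w < P → OptionValues g (lift y) w → OptionValues g y w
        down w w<P (a , move , ga≡w)
          with small-option-lifted y a move (subst (_< P) (sym ga≡w) w<P)
        ... | z , refl = z , unmove ,
          trans (sym (ih (move-size unmove) (inj₁ (subst (_< P) (sym ga≡w) w<P)))) ga≡w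
          where
          unmove : Move y z
          unmove = unlift-move y z move
        up : ∀ w → w < P → OptionValues g y w → OptionValues g (lift y) w
        up w w<P (z , move , gz≡w) = lift z , lift-move y z move ,
          trans (ih (move-size move) (inj₂ (subst (_< P) (sym gz≡w) w<P))) gz≡w

    periodic : ∀ l x₀ r s → g (x₀ , r + l * P , s + l * P) < P →
      g (x₀ , r + l * P , s + l * P) ≡ g (x₀ , r , s)
    periodic zero x₀ r s _ rewrite +-identityʳ r | +-identityʳ s = refl
    periodic (suc l) x₀ r s g< = begin
      g (x₀ , r + suc l * P , s + suc l * P) ≡⟨ cong g lifted ⟩
      g (lift y)                             ≡⟨ g-lift≡ ⟩
      g y                                    ≡⟨ periodic l x₀ r s (subst (_< P) g-lift≡ g-lift<) ⟩
      g (x₀ , r , s)                         ∎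
      where
      open ≡-Reasoning
      y : Pos
      y = x₀ , r + l * P , s + l * P
      lifted : (x₀ , r + suc l * P , s + suc l * P) ≡ lift y
      lifted = cong₂ (λ u v → x₀ , u , v) (one-more-block r l P) (one-more-block s l P)
      g-lift< : g (lift y) < P
      g-lift< = subst (λ z → g z < P) lifted g<
      g-lift≡ : g (lift y) ≡ g y
      g-lift≡ = lift-invariant y (inj₁ g-lift<)

    reduce : ∀ x₀ x₁ x₂ → g (x₀ , x₁ , x₂) < P →
      x₁ ≡ x₁ % P + (x₂ / P) * P × g (x₀ , x₁ % P , x₂ % P) ≡ g (x₀ , x₁ , x₂)
    reduce x₀ x₁ x₂ g< =
      x₁-split , sym (trans (cong g split) (periodic l x₀ r s (subst (λ z → g z < P) split g<)))
      where
      l r s : ℕ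
      l = x₂ / P
      r = x₁ % P
      s = x₂ % P
      x₁-split : x₁ ≡ r + l * P
      x₁-split = trans (m≡m%n+[m/n]*n x₁ P) (cong (λ q → r + q * P) (same-block x₀ x₁ x₂ g<))
      split : (x₀ , x₁ , x₂) ≡ (x₀ , r + l * P , s + l * P)
      split = cong₂ (λ u v → x₀ , u , v) x₁-split (m≡m%n+[m/n]*n x₂ P)

  -- If 2^k ≤ g(x₀, r, s) < 2^(k+1) and r ≤ s < 2^(k+1), then r < 2^k: otherwise
  -- the option (0, t ⊕ s', s) with t = v - 2^k, s' = s - 2^k has value v.
  heap₁-below : ∀ k x₀ r s → r ≤ s → s < 2 ^ suc k →
    2 ^ k ≤ g (x₀ , r , s) → g (x₀ , r , s) < 2 ^ suc k → r < 2 ^ k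
  heap₁-below k x₀ r s r≤s s<2H H≤v v<2H =
    ≰⇒> λ H≤r → proj₁ (sg (x₀ , r , s)) (value-reached H≤r)
    where
    H v t s' y : ℕ
    H = 2 ^ k
    instance
      H-nonZero : NonZero H
      H-nonZero = m^n≢0 2 k
    v = g (x₀ , r , s)
    t = v ∸ H
    s' = s ∸ H
    y = t ⊕ s'
    value-reached : H ≤ r → OptionValues g (x₀ , r , s) v
    value-reached H≤r = (0 , y , s) , move , value
      where
      H≤s : H ≤ s
      H≤s = ≤-trans H≤r r≤s
      s'<H : s' < H
      s'<H = ∸-half-below H s<2H
      y<H : y < H
      y<H = ⊕-bound k t s' (∸-half-below H v<2H) s'<H
      y<r : y < r
      y<r = <-≤-trans y<H H≤r
      move : Move (x₀ , r , s) (0 , y , s)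
      move = z≤n , <⇒≤ y<r , ≤-refl , +-monoˡ-< s (<-≤-trans y<r (m≤n+m r x₀)) , inj₂ refl
      value : g (0 , y , s) ≡ v
      value = begin
        g (0 , y , s)               ≡⟨ nim-plane y s ⟩
        y ⊕ s                       ≡⟨ cong₂ _⊕_ (sym (+-identityʳ y)) s-split ⟩
        (y + 0 * H) ⊕ (s' + 1 * H)  ≡⟨ ⊕-block k 0 1 y s' y<H s'<H ⟩
        (y ⊕ s') + 1 * H            ≡⟨ cong₂ _+_ (⊕-involutive t s') (+-identityʳ H) ⟩
        t + H                       ≡⟨ m∸n+n≡m H≤v ⟩
        v                           ∎
        where
        open ≡-Reasoning
        s-split : s ≡ s' + 1 * H
        s-split = trans (sym (m∸n+n≡m H≤s)) (cong (s' +_) (sym (+-identityʳ H)))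

theorem4p5 : (g : Pos → ℕ) → IsSG g →
    (x₀ x₁ x₂ v k : ℕ) → x₁ ≤ x₂ → g (x₀ , x₁ , x₂) ≡ v → 1 ≤ v →
    2 ^ (k ∸ 1) ≤ v → v < 2 ^ k →
    Σ ℕ λ h₀ → Σ ℕ λ h₁ → Σ ℕ λ h₂ → Σ ℕ λ l →
      h₀ ≤ v × h₁ ≤ 2 ^ (k ∸ 1) ∸ 1 × h₂ ≤ 2 ^ k ∸ 1 ×
      g (h₀ , h₁ , h₂) ≡ g (x₀ , x₁ , x₂) ×
      x₀ ≡ h₀ × x₁ ≡ h₁ + l * 2 ^ k × x₂ ≡ h₂ + l * 2 ^ k
theorem4p5 g sg x₀ x₁ x₂ v zero _ _ 1≤v _ v<1 = ⊥-elim (<⇒≱ v<1 1≤v)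
theorem4p5 g sg x₀ x₁ x₂ v (suc k) x₁≤x₂ refl _ H≤v v<P =
  x₀ , r , s , l , x₀≤v , <⇒≤pred r<H , <⇒≤pred (m%n<n x₂ P) , g-reduced ,
  refl , x₁-split , m≡m%n+[m/n]*n x₂ P
  where
  open ExcoNim g sg
  open Period (suc k)
  l r s : ℕ
  l = x₂ / P
  r = x₁ % P
  s = x₂ % P
  x₁-split : x₁ ≡ r + l * P
  x₁-split = proj₁ (reduce x₀ x₁ x₂ v<P)
  g-reduced : g (x₀ , r , s) ≡ g (x₀ , x₁ , x₂)
  g-reduced = proj₂ (reduce x₀ x₁ x₂ v<P)
  x₀≤v : x₀ ≤ v
  x₀≤v = ≤-trans (m≤m+n x₀ (x₁ ⊕ x₂)) (lower-bound x₀ x₁ x₂)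
  r≤s : r ≤ s
  r≤s = +-cancelʳ-≤ (l * P) r s (subst₂ _≤_ x₁-split (m≡m%n+[m/n]*n x₂ P) x₁≤x₂)
  r<H : r < 2 ^ k
  r<H = heap₁-below k x₀ r s r≤s (m%n<n x₂ P)
          (subst (2 ^ k ≤_) (sym g-reduced) H≤v) (subst (_< P) (sym g-reduced) v<P)
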